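{- Let $T$ be a theory in a first-order language and $\varphi(x_1,\dots,x_n,y)$ a formula in that language. If $\varphi(x_1,\dots,x_n,y)$ has finite satisfiability gap in $T$, then so does $\forall y.\,\varphi(x_1,\dots,x_n,y)$.
   Context: For a finite structure $M$ and a formula $\psi(x_1,\dots,x_m)$, $\mathrm{ds}_M(\psi)=|\{(a_1,\dots,a_m)\in M^m : M\models\psi(a_1,\dots,a_m)\}|/|M|^m$. A formula $\psi$ has finite satisfiability gap in $T$ if there is $\varepsilon>0$ such that for every finite model $M$ of $T$, either $\mathrm{ds}_M(\psi)=1$ or $\mathrm{ds}_M(\psi)\le1-\varepsilon$. -}

module Defs where

open import Data.Nat as ℕ using (ℕ; zero; suc; _^_; _+_)
open import Data.Nat.Properties using (m^n≢0)
open import Data.Fin using (Fin; zero; suc)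
open import Data.Vec using (Vec; []; _∷_)
open import Data.Vec.Functional as VF using (Vector)
open import Data.Bool using (Bool; true; false; _∧_; _∨_; not; if_then_else_)
open import Data.Integer using (+_)
open import Data.Rational using (ℚ; _/_; 1ℚ; 0ℚ; _-_; _≤_; _<_)
open import Data.Product using (Σ; _×_)
open import Data.Sum using (_⊎_)
open import Relation.Binary.PropositionalEquality using (_≡_)

record Language : Set₁ where
  field
    FunSym : Set
    funArity : FunSym → ℕ
    RelSym : Set
    relArity : RelSym → ℕ
open Language public

module _ (L : Language) where

  data Term (n : ℕ) : Set where
    var : Fin n → Term n
    app : (f : FunSym L) → Vec (Term n) (funArity L f) → Term n

  -- First-order formulas (with equality) with free variables among Fin n.
  -- Quantifiers bind variable 'zero'; the old variable i becomes 'suc i'.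
  data Formula (n : ℕ) : Set where
    ⊤' ⊥' : Formula n
    _≐_ : Term n → Term n → Formula n
    rel : (R : RelSym L) → Vec (Term n) (relArity L R) → Formula n
    ¬' : Formula n → Formula n
    _∧'_ _∨'_ _⇒'_ : Formula n → Formula n → Formula n
    ∀' ∃' : Formula (suc n) → Formula n

  Sentence : Set
  Sentence = Formula 0

  Theory : Set₁
  Theory = Sentence → Set

  -- A finite L-structure; its universe is Fin (suc pred) (nonempty, as usual).
  record FinStructure : Set where
    field
      pred : ℕ
      funInterp : (f : FunSym L) → Vec (Fin (suc pred)) (funArity L f) → Fin (suc pred)
      relInterp : (R : RelSym L) → Vec (Fin (suc pred)) (relArity L R) → Bool

  card : FinStructure → ℕ
  card M = suc (FinStructure.pred M)

  Univ : FinStructure → Set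
  Univ M = Fin (card M)

  allFinB : ∀ {k} → (Fin k → Bool) → Bool
  allFinB {zero} p = true
  allFinB {suc k} p = p zero ∧ allFinB (λ i → p (suc i))

  anyFinB : ∀ {k} → (Fin k → Bool) → Bool
  anyFinB {zero} p = false
  anyFinB {suc k} p = p zero ∨ anyFinB (λ i → p (suc i))

  _=ᶠ_ : ∀ {k} → Fin k → Fin k → Bool
  zero =ᶠ zero = true
  zero =ᶠ suc _ = false
  suc _ =ᶠ zero = false
  suc i =ᶠ suc j = i =ᶠ j

  module _ (M : FinStructure) where
    open FinStructure M

    mutual
      evalTerm : ∀ {n} → Term n → Vector (Univ M) n → Univ M
      evalTerm (var i) ρ = ρ i
      evalTerm (app f ts) ρ = funInterp f (evalTerms ts ρ)

      evalTerms : ∀ {n m} → Vec (Term n) m → Vector (Univ M) n → Vec (Univ M) m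
      evalTerms [] ρ = []
      evalTerms (t ∷ ts) ρ = evalTerm t ρ ∷ evalTerms ts ρ

    sat : ∀ {n} → Formula n → Vector (Univ M) n → Bool
    sat ⊤' ρ = true
    sat ⊥' ρ = false
    sat (s ≐ t) ρ = evalTerm s ρ =ᶠ evalTerm t ρ
    sat (rel R ts) ρ = relInterp R (evalTerms ts ρ)
    sat (¬' φ) ρ = not (sat φ ρ)
    sat (φ ∧' ψ) ρ = sat φ ρ ∧ sat ψ ρ
    sat (φ ∨' ψ) ρ = sat φ ρ ∨ sat ψ ρ
    sat (φ ⇒' ψ) ρ = not (sat φ ρ) ∨ sat ψ ρ
    sat (∀' φ) ρ = allFinB (λ a → sat φ (a VF.∷ ρ))
    sat (∃' φ) ρ = anyFinB (λ a → sat φ (a VF.∷ ρ))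

  _⊨_ : FinStructure → Sentence → Set
  M ⊨ σ = sat M σ (λ ()) ≡ true

  IsModel : FinStructure → Theory → Set
  IsModel M T = ∀ σ → T σ → M ⊨ σ

  sumFin : ∀ {k} → (Fin k → ℕ) → ℕ
  sumFin {zero} f = 0
  sumFin {suc k} f = f zero + sumFin (λ i → f (suc i))

  countB : ∀ {k} n → (Vector (Fin k) n → Bool) → ℕ
  countB zero p = if p (λ ()) then 1 else 0
  countB (suc n) p = sumFin (λ a → countB n (λ ρ → p (a VF.∷ ρ)))

  ds : FinStructure → ∀ {n} → Formula n → ℚ
  ds M {n} ψ = _/_ (+ countB n (sat M ψ)) (card M ^ n) {{m^n≢0 (card M) n}}

  HasFinSatGap : Theory → ∀ {n} → Formula n → Set
  HasFinSatGap T ψ =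
    Σ ℚ λ ε → (0ℚ < ε) ×
      (∀ (M : FinStructure) → IsModel M T → (ds M ψ ≡ 1ℚ) ⊎ (ds M ψ ≤ 1ℚ - ε))

-- If φ holds on all of M^(n+1) then ∀y.φ holds on all of M^n; in any case double counting
-- gives |M| · #{a : M ⊨ ∀y.φ(a)} ≤ #{(a, b) : M ⊨ φ(a, b)}, i.e. ds_M(∀y.φ) ≤ ds_M(φ).
-- Hence the gap ε of φ is also a gap for ∀y.φ.
module Submission where

open import Defs
open import Data.Nat as ℕ using (ℕ; zero; suc; _+_; _*_; _^_; _≤_; z≤n; s≤s; NonZero)
open import Data.Nat.Properties as ℕ
  using (≤-refl; ≤-trans; ≤-reflexive; +-mono-≤; +-monoʳ-≤; *-monoˡ-≤; *-zeroʳ; *-assoc; *-comm;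
         +-identityʳ; +-cancelˡ-≡; n≤0⇒n≡0; m^n≢0)
open import Data.Fin using (Fin; zero; suc)
open import Data.Vec.Functional as VF using (Vector)
open import Data.Bool using (Bool; true; false; _∨_; not; if_then_else_)
import Data.Integer as ℤ
import Data.Integer.Properties as ℤ
open import Data.Rational as ℚ using (_/_; 1ℚ)
import Data.Rational.Properties as ℚ
open import Data.Rational.Unnormalised as ℚᵘ using (mkℚᵘ; *≤*; *≡*)
import Data.Rational.Unnormalised.Properties as ℚᵘ
open import Data.Product using (_,_)
open import Data.Sum using (_⊎_; inj₁; inj₂)
open import Relation.Binary.PropositionalEquality
open import Algebra.Properties.CommutativeSemigroup ℕ.+-commutativeSemigroup using (interchange)

-- + a / suc b is definitionally fromℚᵘ (mkℚᵘ (ℤ.+ a) b), which lets us argue in ℚᵘ.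
/-mono-≤ : ∀ a b c d .{{_ : NonZero b}} .{{_ : NonZero d}} → a * d ≤ c * b → ℤ.+ a / b ℚ.≤ ℤ.+ c / d
/-mono-≤ a (suc b) c (suc d) ad≤cb = ℚ.toℚᵘ-cancel-≤
  (ℚᵘ.≤-respˡ-≃ (ℚᵘ.≃-sym (ℚ.toℚᵘ-fromℚᵘ (mkℚᵘ (ℤ.+ a) b)))
   (ℚᵘ.≤-respʳ-≃ (ℚᵘ.≃-sym (ℚ.toℚᵘ-fromℚᵘ (mkℚᵘ (ℤ.+ c) d)))
     (*≤* (subst₂ ℤ._≤_ (ℤ.pos-* a (suc d)) (ℤ.pos-* c (suc b)) (ℤ.+≤+ ad≤cb)))))

/≡1⇒≡ : ∀ a b .{{_ : NonZero b}} → ℤ.+ a / b ≡ 1ℚ → a ≡ b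
/≡1⇒≡ a (suc b) a/b≡1 = trans (sym (ℕ.*-identityʳ a))
  (trans (ℚ.normalize-injective-≃ a 1 (suc b) 1 a/b≡1) (ℕ.*-identityˡ (suc b)))

n/n≡1 : ∀ n .{{_ : NonZero n}} → ℤ.+ n / n ≡ 1ℚ
n/n≡1 (suc n) = ℚ.fromℚᵘ-cong {mkℚᵘ (ℤ.+ suc n) n} {ℚᵘ.1ℚᵘ}
  (*≡* (trans (ℤ.*-identityʳ (ℤ.+ suc n)) (sym (ℤ.*-identityˡ (ℤ.+ suc n)))))

𝟙 : Bool → ℕ
𝟙 b = if b then 1 else 0

𝟙-mono-≤ : ∀ b c → (b ≡ true → c ≡ true) → 𝟙 b ≤ 𝟙 c
𝟙-mono-≤ false c b⇒c = z≤n
𝟙-mono-≤ true  c b⇒c rewrite b⇒c refl = ≤-refl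

𝟙-+-𝟙-not : ∀ b → 𝟙 b + 𝟙 (not b) ≡ 1
𝟙-+-𝟙-not false = refl
𝟙-+-𝟙-not true  = refl

𝟙-∨-≤ : ∀ b c → 𝟙 (b ∨ c) ≤ 𝟙 b + 𝟙 c
𝟙-∨-≤ false c = ≤-refl
𝟙-∨-≤ true  c = s≤s z≤n

module _ (L : Language) where

  sumFin-cong : ∀ {k} (f g : Fin k → ℕ) → (∀ i → f i ≡ g i) → sumFin L f ≡ sumFin L g
  sumFin-cong {zero}  f g f≗g = refl
  sumFin-cong {suc k} f g f≗g =
    cong₂ _+_ (f≗g zero) (sumFin-cong (λ i → f (suc i)) (λ i → g (suc i)) (λ i → f≗g (suc i)))

  sumFin-mono-≤ : ∀ {k} (f g : Fin k → ℕ) → (∀ i → f i ≤ g i) → sumFin L f ≤ sumFin L g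
  sumFin-mono-≤ {zero}  f g f≤g = z≤n
  sumFin-mono-≤ {suc k} f g f≤g =
    +-mono-≤ (f≤g zero) (sumFin-mono-≤ (λ i → f (suc i)) (λ i → g (suc i)) (λ i → f≤g (suc i)))

  sumFin-+ : ∀ {k} (f g : Fin k → ℕ) → sumFin L (λ i → f i + g i) ≡ sumFin L f + sumFin L g
  sumFin-+ {zero}  f g = refl
  sumFin-+ {suc k} f g =
    trans (cong ((f zero + g zero) +_) (sumFin-+ (λ i → f (suc i)) (λ i → g (suc i))))
          (interchange (f zero) (g zero) _ _)

  sumFin-const : ∀ k c → sumFin L {k} (λ _ → c) ≡ k * c
  sumFin-const zero    c = refl
  sumFin-const (suc k) c = cong (c +_) (sumFin-const k c)

  allFinB-elim : ∀ {k} (f : Fin k → Bool) → allFinB L f ≡ true → ∀ a → f a ≡ true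
  allFinB-elim {suc k} f all-f a with f zero in f0≡ | a
  ... | true | zero  = f0≡
  ... | true | suc a = allFinB-elim (λ i → f (suc i)) all-f a

  not-allFinB⇒anyFinB-not : ∀ {k} (f : Fin k → Bool) →
    not (allFinB L f) ≡ true → anyFinB L (λ a → not (f a)) ≡ true
  not-allFinB⇒anyFinB-not {suc k} f not-all with f zero
  ... | false = refl
  ... | true  = not-allFinB⇒anyFinB-not (λ i → f (suc i)) not-all

  module _ {k : ℕ} where

    countB-mono-≤ : ∀ n (p q : Vector (Fin k) n → Bool) →
      (∀ ρ → p ρ ≡ true → q ρ ≡ true) → countB L n p ≤ countB L n q
    countB-mono-≤ zero    p q p⇒q = 𝟙-mono-≤ (p _) (q _) (p⇒q _)
    countB-mono-≤ (suc n) p q p⇒q = sumFin-mono-≤ _ _ λ a →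
      countB-mono-≤ n (λ ρ → p (a VF.∷ ρ)) (λ ρ → q (a VF.∷ ρ)) (λ ρ → p⇒q (a VF.∷ ρ))

    countB-+-countB-not : ∀ n (p : Vector (Fin k) n → Bool) →
      countB L n p + countB L n (λ ρ → not (p ρ)) ≡ k ^ n
    countB-+-countB-not zero    p = 𝟙-+-𝟙-not (p _)
    countB-+-countB-not (suc n) p = begin
      countB L (suc n) p + countB L (suc n) (λ ρ → not (p ρ))
        ≡⟨ sumFin-+ (λ a → countB L n (p∷ a)) (λ a → countB L n (λ ρ → not (p∷ a ρ))) ⟨
      sumFin L (λ a → countB L n (p∷ a) + countB L n (λ ρ → not (p∷ a ρ)))
        ≡⟨ sumFin-cong _ _ (λ a → countB-+-countB-not n (p∷ a)) ⟩
      sumFin L {k} (λ _ → k ^ n)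
        ≡⟨ sumFin-const k (k ^ n) ⟩
      k ^ suc n ∎
      where
      open ≡-Reasoning
      p∷ : Fin k → Vector (Fin k) n → Bool
      p∷ a ρ = p (a VF.∷ ρ)

    countB≡^⇒countB-not≡0 : ∀ n (p : Vector (Fin k) n → Bool) →
      countB L n p ≡ k ^ n → countB L n (λ ρ → not (p ρ)) ≡ 0
    countB≡^⇒countB-not≡0 n p full = +-cancelˡ-≡ (countB L n p) _ _
      (trans (countB-+-countB-not n p) (trans (sym full) (sym (+-identityʳ _))))

    countB-not≡0⇒countB≡^ : ∀ n (p : Vector (Fin k) n → Bool) →
      countB L n (λ ρ → not (p ρ)) ≡ 0 → countB L n p ≡ k ^ n
    countB-not≡0⇒countB≡^ n p empty = trans (sym (+-identityʳ _))
      (trans (cong (countB L n p +_) (sym empty)) (countB-+-countB-not n p))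

    countB-false : ∀ n → countB L {k} n (λ _ → false) ≡ 0
    countB-false zero    = refl
    countB-false (suc n) =
      trans (sumFin-cong {k} _ (λ _ → 0) (λ _ → countB-false n)) (trans (sumFin-const k 0) (*-zeroʳ k))

    countB-∨-≤ : ∀ n (p q : Vector (Fin k) n → Bool) →
      countB L n (λ ρ → p ρ ∨ q ρ) ≤ countB L n p + countB L n q
    countB-∨-≤ zero    p q = 𝟙-∨-≤ (p _) (q _)
    countB-∨-≤ (suc n) p q = ≤-trans
      (sumFin-mono-≤ _ _ λ a → countB-∨-≤ n (λ ρ → p (a VF.∷ ρ)) (λ ρ → q (a VF.∷ ρ)))
      (≤-reflexive (sumFin-+ (λ a → countB L n (λ ρ → p (a VF.∷ ρ)))
                             (λ a → countB L n (λ ρ → q (a VF.∷ ρ)))))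

    countB-anyFinB-≤ : ∀ n {j} (f : Fin j → Vector (Fin k) n → Bool) →
      countB L n (λ ρ → anyFinB L (λ a → f a ρ)) ≤ sumFin L (λ a → countB L n (f a))
    countB-anyFinB-≤ n {zero}  f = ≤-reflexive (countB-false n)
    countB-anyFinB-≤ n {suc j} f = ≤-trans (countB-∨-≤ n (f zero) _)
      (+-monoʳ-≤ (countB L n (f zero)) (countB-anyFinB-≤ n (λ a → f (suc a))))

    module _ (n : ℕ) (q : Vector (Fin k) (suc n) → Bool) where

      private
        ∀q : Vector (Fin k) n → Bool
        ∀q ρ = allFinB L (λ a → q (a VF.∷ ρ))

      k*countB-allFinB≤countB : k * countB L n ∀q ≤ countB L (suc n) q
      k*countB-allFinB≤countB = ≤-trans (≤-reflexive (sym (sumFin-const k (countB L n ∀q))))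
        (sumFin-mono-≤ _ _ λ a → countB-mono-≤ n ∀q (λ ρ → q (a VF.∷ ρ))
          (λ ρ all-q → allFinB-elim (λ b → q (b VF.∷ ρ)) all-q a))

      -- A counterexample ρ to ∀q yields some a with ¬ q (a ∷ ρ), so the non-∀q tuples
      -- are counted by the non-q tuples.
      countB-allFinB-full : countB L (suc n) q ≡ k ^ suc n → countB L n ∀q ≡ k ^ n
      countB-allFinB-full q-full = countB-not≡0⇒countB≡^ n ∀q (n≤0⇒n≡0 (begin
        countB L n (λ ρ → not (∀q ρ))
          ≤⟨ countB-mono-≤ n _ _ (λ ρ → not-allFinB⇒anyFinB-not (λ a → q (a VF.∷ ρ))) ⟩
        countB L n (λ ρ → anyFinB L (λ a → not (q (a VF.∷ ρ))))
          ≤⟨ countB-anyFinB-≤ n (λ a ρ → not (q (a VF.∷ ρ))) ⟩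
        countB L (suc n) (λ ρ → not (q ρ))
          ≡⟨ countB≡^⇒countB-not≡0 (suc n) q q-full ⟩
        0 ∎))
        where open ℕ.≤-Reasoning

  module _ (M : FinStructure L) {n : ℕ} (φ : Formula L (suc n)) where

    private
      K = card L M
      instance
        K^n≢0   = m^n≢0 K n
        K^1+n≢0 = m^n≢0 K (suc n)

    ds-∀'-≤ : ds L M (∀' φ) ℚ.≤ ds L M φ
    ds-∀'-≤ = /-mono-≤ c∀ (K ^ n) c (K ^ suc n) (begin
      c∀ * (K * K ^ n) ≡⟨ *-assoc c∀ K (K ^ n) ⟨
      c∀ * K * K ^ n   ≡⟨ cong (_* K ^ n) (*-comm c∀ K) ⟩
      K * c∀ * K ^ n   ≤⟨ *-monoˡ-≤ (K ^ n) (k*countB-allFinB≤countB n (sat L M φ)) ⟩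
      c * K ^ n        ∎)
      where
      open ℕ.≤-Reasoning
      c∀ = countB L n (sat L M (∀' φ))
      c  = countB L (suc n) (sat L M φ)

    ds-∀'-≡1 : ds L M φ ≡ 1ℚ → ds L M (∀' φ) ≡ 1ℚ
    ds-∀'-≡1 ds≡1 = trans
      (cong (λ c → ℤ.+ c / K ^ n) (countB-allFinB-full n (sat L M φ) (/≡1⇒≡ _ (K ^ suc n) ds≡1)))
      (n/n≡1 (K ^ n))

proposition3p2 : (L : Language) (T : Theory L) (n : ℕ) (φ : Formula L (suc n)) →
    HasFinSatGap L T φ → HasFinSatGap L T (∀' φ)
proposition3p2 L T n φ (ε , 0<ε , gap) = ε , 0<ε , λ M M⊨T → gap∀ M (gap M M⊨T)
  where
  gap∀ : ∀ M → (ds L M φ ≡ 1ℚ) ⊎ (ds L M φ ℚ.≤ 1ℚ ℚ.- ε) →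
         (ds L M (∀' φ) ≡ 1ℚ) ⊎ (ds L M (∀' φ) ℚ.≤ 1ℚ ℚ.- ε)
  gap∀ M (inj₁ ds≡1)  = inj₁ (ds-∀'-≡1 L M φ ds≡1)
  gap∀ M (inj₂ ds≤1-ε) = inj₂ (ℚ.≤-trans (ds-∀'-≤ L M φ) ds≤1-ε)
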